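{- Let $n,k,t,m$ be positive integers with $t\le k$ and $n\ge mt$. Then for any family $\mathcal{T}=\{T_1,T_2,\dots,T_m\}\subseteq\binom{[n]}{t}$ of $m$ $t$-subsets of $[n]$, $|\mathcal{S}(\mathcal{T})|\le\ell(n,k,t,m)$.
   Context: For $T\in\binom{[n]}{t}$, $\mathcal{S}(T)=\{F\in\binom{[n]}{k}:T\subseteq F\}$ and $\mathcal{S}(\mathcal{T})=\bigcup_{i=1}^m\mathcal{S}(T_i)$. $\ell(n,k,t,m)$ denotes $|\mathcal{S}(\mathcal{T}')|$ for any family $\mathcal{T}'$ of $m$ distinct pairwise disjoint $t$-subsets of $[n]$. -}

module Defs where

open import Data.Nat using (ℕ; zero; suc)
open import Data.Bool using (true; false)
open import Data.Fin using (Fin)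
open import Data.Fin.Subset using (Subset; _⊆_; _∩_; ∣_∣; Empty; inside; outside)
open import Data.Fin.Subset.Properties using (_⊆?_)
open import Data.List using (List; []; _∷_; map; _++_; filter; length)
open import Data.Vec using (_∷_; [])
open import Data.Product using (Σ; _×_)
open import Relation.Nullary using (¬_; Dec)
open import Relation.Binary.PropositionalEquality using (_≡_)
open import Data.Nat.Properties using (_≟_)
open import Data.Fin.Properties using (any?)

allSubsets : (n : ℕ) → List (Subset n)
allSubsets zero = [] ∷ []
allSubsets (suc n) = map (outside ∷_) (allSubsets n) ++ map (inside ∷_) (allSubsets n)

kSubsets : (n k : ℕ) → List (Subset n)
kSubsets n k = filter (λ F → ∣ F ∣ ≟ k) (allSubsets n)

S : (n k m : ℕ) → (Fin m → Subset n) → List (Subset n)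
S n k m T = filter (λ F → any? (λ i → T i ⊆? F)) (kSubsets n k)

sizeS : (n k m : ℕ) → (Fin m → Subset n) → ℕ
sizeS n k m T = length (S n k m T)

IsTFamily : (n t m : ℕ) → (Fin m → Subset n) → Set
IsTFamily n t m T = (i : Fin m) → ∣ T i ∣ ≡ t

Distinct : (n m : ℕ) → (Fin m → Subset n) → Set
Distinct n m T = (i j : Fin m) → T i ≡ T j → i ≡ j

PairwiseDisjoint : (n m : ℕ) → (Fin m → Subset n) → Set
PairwiseDisjoint n m T = (i j : Fin m) → ¬ (i ≡ j) → Empty (T i ∩ T j)

-- Compression. While two members T i, T l share a point x, some point y lies outside ⋃ T
-- (|⋃ T| < m t ≤ n); moving x to y inside T i keeps the sizes, enlarges ⋃ T, and does not decrease
-- |𝒮(T)|, because F ↦ (x y) F maps the sets that leave 𝒮 injectively to sets that enter it.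
-- Once the family is pairwise disjoint, transpositions align it with T′ member by member, and |𝒮|
-- is invariant under relabelling [n]. Counting is done over the cube of all subsets of [n], on which
-- relabelling by a permutation is a bijection.
module Submission where

open import Defs
open import Data.Bool using (Bool; true; false; T; _∧_; not; if_then_else_)
open import Data.Bool.Properties using (∧-comm)
open import Data.Empty using (⊥-elim)
open import Data.Fin using (Fin; zero; suc; punchIn)
open import Data.Fin.Permutation using (Permutation′; _⟨$⟩ʳ_; remove; transpose; punchIn-permute)
open import Data.Fin.Properties using (any?; all?; ¬∀⟶∃¬) renaming (_≟_ to _≟ᶠ_)
open import Data.Fin.Subset using (Subset; inside; outside; ∣_∣; _∈_; _∉_; _⊆_; _⊂_; _∪_; _∩_; _-_; ⊤; ∁; ⋃)
open import Data.Fin.Subset.Properties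
  using (_∈?_; _⊆?_; nonempty?; ⊆-reflexive; ⊆-trans; ∉⊥; ∣⊥∣≡0; ∣⊤∣≡n; x∈p∪q⁺; x∈p∪q⁻; x∈p∩q⁺; x∈p∩q⁻;
         x∈p∧x≢y⇒x∈p-y; x∈p⇒∣p-x∣<∣p∣; p⊆q⇒∣p∣≤∣q∣; p⊂q⇒∣p∣<∣q∣; p⊂q⇒∁p⊃∁q)
open import Data.List using ([]; _∷_; map; _++_; filter; length)
import Data.List as List
open import Data.List.Properties using (length-++; filter-++)
open import Data.Nat using (ℕ; zero; suc; _+_; _*_; _≤_; _<_; z≤n; s≤s; NonZero)
open import Data.Nat.Induction using (<-wellFounded)
open import Data.Nat.Properties
  using (_≟_; ≤-refl; ≤-reflexive; ≤-trans; ≤-<-trans; <-≤-trans; <⇒≤; <⇒≱; n≤1+n; +-suc;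
         +-mono-≤; +-monoʳ-≤; +-mono-≤-<; +-commutativeSemigroup; module ≤-Reasoning)
open import Algebra.Properties.CommutativeSemigroup +-commutativeSemigroup using (interchange)
open import Data.Product using (∃; _×_; _,_; proj₁; proj₂)
open import Data.Sum using (inj₁; inj₂)
open import Data.Vec using ([]; _∷_; lookup; tabulate; insertAt; removeAt)
open import Data.Vec.Functional using (updateAt)
open import Data.Vec.Functional.Properties using (updateAt-updates; updateAt-minimal)
open import Data.Vec.Properties
  using (lookup∘tabulate; lookup⇒[]=; []=⇒lookup; insertAt-lookup; insertAt-punchIn; insertAt-removeAt; tabulate-cong)
open import Function using (_∘_)
open import Induction.WellFounded using (Acc; acc)
open import Relation.Binary.PropositionalEquality
  using (_≡_; _≢_; refl; sym; trans; cong; cong₂; subst; module ≡-Reasoning)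
open import Relation.Nullary using (Dec; yes; no; does; ¬_; ¬?; _×-dec_; contradiction)
open import Relation.Nullary.Decidable using (dec-true; dec-false; decidable-stable)
open import Relation.Unary using (Pred; Decidable)

does-sound : ∀ {a} {A : Set a} (a? : Dec A) → T (does a?) → A
does-sound (yes a) _ = a

does-complete : ∀ {a} {A : Set a} (a? : Dec A) → A → T (does a?)
does-complete (yes _) _ = _
does-complete (no ¬a) a = ¬a a

count : ∀ n → (Subset n → Bool) → ℕ
count zero    p = if p [] then 1 else 0
count (suc n) p = count n (p ∘ (outside ∷_)) + count n (p ∘ (inside ∷_))

count-cong : ∀ n {p q : Subset n → Bool} → (∀ v → p v ≡ q v) → count n p ≡ count n q
count-cong zero    p≗q rewrite p≗q [] = refl
count-cong (suc n) p≗q =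
  cong₂ _+_ (count-cong n (p≗q ∘ (outside ∷_))) (count-cong n (p≗q ∘ (inside ∷_)))

count-mono : ∀ n {p q : Subset n → Bool} → (∀ v → T (p v) → T (q v)) → count n p ≤ count n q
count-mono zero {p} {q} p⇒q with p [] | q [] | p⇒q []
... | false | _     | _     = z≤n
... | true  | true  | _     = ≤-refl
... | true  | false | p⇒q[] with () ← p⇒q[] _
count-mono (suc n) p⇒q =
  +-mono-≤ (count-mono n (p⇒q ∘ (outside ∷_))) (count-mono n (p⇒q ∘ (inside ∷_)))

count-mono-dec : ∀ {n a b} {P : Pred (Subset n) a} {Q : Pred (Subset n) b}
  (P? : Decidable P) (Q? : Decidable Q) → (∀ {v} → P v → Q v) → count n (does ∘ P?) ≤ count n (does ∘ Q?)
count-mono-dec {n} P? Q? P⇒Q = count-mono n (λ v → does-complete (Q? v) ∘ P⇒Q ∘ does-sound (P? v))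

count-split : ∀ n (p q : Subset n → Bool) →
  count n p ≡ count n (λ v → p v ∧ q v) + count n (λ v → p v ∧ not (q v))
count-split zero p q with p [] | q []
... | false | _     = refl
... | true  | true  = refl
... | true  | false = refl
count-split (suc n) p q =
  trans (cong₂ _+_ (count-split n p₀ q₀) (count-split n p₁ q₁))
        (interchange (count n (λ v → p₀ v ∧ q₀ v)) (count n (λ v → p₀ v ∧ not (q₀ v)))
                     (count n (λ v → p₁ v ∧ q₁ v)) (count n (λ v → p₁ v ∧ not (q₁ v))))
  where
  p₀ = p ∘ (outside ∷_)
  q₀ = q ∘ (outside ∷_)
  p₁ = p ∘ (inside ∷_)
  q₁ = q ∘ (inside ∷_)

count-insertAt : ∀ n (j : Fin (suc n)) (p : Subset (suc n) → Bool) →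
  count (suc n) p ≡ count n (λ u → p (insertAt u j outside)) + count n (λ u → p (insertAt u j inside))
count-insertAt n       zero    p = refl
count-insertAt (suc n) (suc j) p =
  trans (cong₂ _+_ (count-insertAt n j p₀) (count-insertAt n j p₁))
        (interchange (count n (λ u → p₀ (insertAt u j outside))) (count n (λ u → p₀ (insertAt u j inside)))
                     (count n (λ u → p₁ (insertAt u j outside))) (count n (λ u → p₁ (insertAt u j inside))))
  where
  p₀ = p ∘ (outside ∷_)
  p₁ = p ∘ (inside ∷_)

-- z ∈ relabel π v  iff  π z ∈ v, so relabel π v is the preimage of v under π.
relabel : ∀ {n} → Permutation′ n → Subset n → Subset n
relabel π v = tabulate (λ z → lookup v (π ⟨$⟩ʳ z))

relabel-insertAt : ∀ {n} (π : Permutation′ (suc n)) (u : Subset n) (b : Bool) →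
  relabel π (insertAt u (π ⟨$⟩ʳ zero) b) ≡ b ∷ relabel (remove zero π) u
relabel-insertAt π u b = cong₂ _∷_ (insertAt-lookup u (π ⟨$⟩ʳ zero) b) (tabulate-cong λ z → begin
  lookup (insertAt u (π ⟨$⟩ʳ zero) b) (π ⟨$⟩ʳ suc z)
    ≡⟨ cong (lookup (insertAt u (π ⟨$⟩ʳ zero) b)) (punchIn-permute π zero z) ⟩
  lookup (insertAt u (π ⟨$⟩ʳ zero) b) (punchIn (π ⟨$⟩ʳ zero) (remove zero π ⟨$⟩ʳ z))
    ≡⟨ insertAt-punchIn u (π ⟨$⟩ʳ zero) b _ ⟩
  lookup u (remove zero π ⟨$⟩ʳ z) ∎)
  where open ≡-Reasoning

count-relabel : ∀ n (π : Permutation′ n) (p : Subset n → Bool) → count n (p ∘ relabel π) ≡ count n p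
count-relabel zero    π p = refl
count-relabel (suc n) π p = begin
  count (suc n) (p ∘ relabel π)
    ≡⟨ count-insertAt n (π ⟨$⟩ʳ zero) (p ∘ relabel π) ⟩
  count n (λ u → p (relabel π (insertAt u (π ⟨$⟩ʳ zero) outside)))
    + count n (λ u → p (relabel π (insertAt u (π ⟨$⟩ʳ zero) inside)))
    ≡⟨ cong₂ _+_ (count-cong n (cong p ∘ λ u → relabel-insertAt π u outside))
                 (count-cong n (cong p ∘ λ u → relabel-insertAt π u inside)) ⟩
  count n (λ u → p (outside ∷ relabel π′ u)) + count n (λ u → p (inside ∷ relabel π′ u))
    ≡⟨ cong₂ _+_ (count-relabel n π′ (p ∘ (outside ∷_))) (count-relabel n π′ (p ∘ (inside ∷_))) ⟩
  count (suc n) p ∎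
  where
  open ≡-Reasoning
  π′ = remove zero π

∣insertAt∣ : ∀ {n} (u : Subset n) (j : Fin (suc n)) (b : Bool) → ∣ insertAt u j b ∣ ≡ ∣ b ∷ u ∣
∣insertAt∣ u             zero    b       = refl
∣insertAt∣ (outside ∷ u) (suc j) b       = ∣insertAt∣ u j b
∣insertAt∣ (inside ∷ u)  (suc j) outside = cong suc (∣insertAt∣ u j outside)
∣insertAt∣ (inside ∷ u)  (suc j) inside  = cong suc (∣insertAt∣ u j inside)

∣∷∣-cong : ∀ {n} b (u w : Subset n) → ∣ u ∣ ≡ ∣ w ∣ → ∣ b ∷ u ∣ ≡ ∣ b ∷ w ∣
∣∷∣-cong outside _ _ ∣u∣≡∣w∣ = ∣u∣≡∣w∣
∣∷∣-cong inside  _ _ ∣u∣≡∣w∣ = cong suc ∣u∣≡∣w∣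

∣relabel∣ : ∀ n (π : Permutation′ n) (v : Subset n) → ∣ relabel π v ∣ ≡ ∣ v ∣
∣relabel∣ zero    π [] = refl
∣relabel∣ (suc n) π v = begin
  ∣ relabel π v ∣                        ≡⟨ cong (∣_∣ ∘ relabel π) (sym (insertAt-removeAt v j)) ⟩
  ∣ relabel π (insertAt u j b) ∣         ≡⟨ cong ∣_∣ (relabel-insertAt π u b) ⟩
  ∣ b ∷ relabel (remove zero π) u ∣      ≡⟨ ∣∷∣-cong b (relabel (remove zero π) u) u (∣relabel∣ n (remove zero π) u) ⟩
  ∣ b ∷ u ∣                              ≡⟨ sym (∣insertAt∣ u j b) ⟩
  ∣ insertAt u j b ∣                     ≡⟨ cong ∣_∣ (insertAt-removeAt v j) ⟩
  ∣ v ∣                                  ∎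
  where
  open ≡-Reasoning
  j = π ⟨$⟩ʳ zero
  u = removeAt v j
  b = lookup v j

∈-relabel⁻ : ∀ {n} (π : Permutation′ n) {v z} → z ∈ relabel π v → π ⟨$⟩ʳ z ∈ v
∈-relabel⁻ π {v} {z} z∈ =
  lookup⇒[]= _ v (trans (sym (lookup∘tabulate (lookup v ∘ (π ⟨$⟩ʳ_)) z)) ([]=⇒lookup z∈))

∈-relabel⁺ : ∀ {n} (π : Permutation′ n) {v z} → π ⟨$⟩ʳ z ∈ v → z ∈ relabel π v
∈-relabel⁺ π {v} {z} πz∈ =
  lookup⇒[]= z (relabel π v) (trans (lookup∘tabulate (lookup v ∘ (π ⟨$⟩ʳ_)) z) ([]=⇒lookup πz∈))

relabel-mono : ∀ {n} (π : Permutation′ n) {p q} → p ⊆ q → relabel π p ⊆ relabel π q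
relabel-mono π p⊆q = ∈-relabel⁺ π ∘ p⊆q ∘ ∈-relabel⁻ π

-- Split both counts along Q and P respectively; the common part P ∩ Q cancels and
-- relabelling by π injects P ∖ Q into Q ∖ P.
count-≤-relabelling : ∀ {n a b} {P : Pred (Subset n) a} {Q : Pred (Subset n) b}
  (P? : Decidable P) (Q? : Decidable Q) (π : Permutation′ n) →
  (∀ {v} → P v × ¬ Q v → Q (relabel π v) × ¬ P (relabel π v)) →
  count n (does ∘ P?) ≤ count n (does ∘ Q?)
count-≤-relabelling {n} P? Q? π P∖Q→Q∖P = begin
  count n p                                              ≡⟨ count-split n p q ⟩
  count n (λ v → p v ∧ q v) + count n (λ v → p v ∧ not (q v))
    ≤⟨ +-mono-≤ (≤-reflexive (count-cong n (λ v → ∧-comm (p v) (q v)))) P∖Q≤Q∖P ⟩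
  count n (λ v → q v ∧ p v) + count n (λ v → q v ∧ not (p v)) ≡⟨ count-split n q p ⟨
  count n q                                              ∎
  where
  open ≤-Reasoning
  p = does ∘ P?
  q = does ∘ Q?
  P∖Q≤Q∖P : count n (λ v → p v ∧ not (q v)) ≤ count n (λ v → q v ∧ not (p v))
  P∖Q≤Q∖P = ≤-trans
    (count-mono-dec (λ v → P? v ×-dec ¬? (Q? v)) (λ v → Q? (relabel π v) ×-dec ¬? (P? (relabel π v))) P∖Q→Q∖P)
    (≤-reflexive (count-relabel n π (λ v → q v ∧ not (p v))))

module _ {b ℓ} {B : Set b} {P : Pred B ℓ} (P? : Decidable P) where

  length-filter-map : ∀ {a} {A : Set a} (f : A → B) xs → length (filter P? (map f xs)) ≡ length (filter (P? ∘ f) xs)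
  length-filter-map f []       = refl
  length-filter-map f (x ∷ xs) with does (P? (f x))
  ... | true  = cong suc (length-filter-map f xs)
  ... | false = length-filter-map f xs

  length-filter-filter : ∀ {q} {Q : Pred B q} (Q? : Decidable Q) xs →
    length (filter Q? (filter P? xs)) ≡ length (filter (λ x → P? x ×-dec Q? x) xs)
  length-filter-filter Q? []       = refl
  length-filter-filter Q? (x ∷ xs) with does (P? x)
  ... | false = length-filter-filter Q? xs
  ... | true with does (Q? x)
  ...   | true  = cong suc (length-filter-filter Q? xs)
  ...   | false = length-filter-filter Q? xs

length-filter-allSubsets : ∀ n {ℓ} {P : Pred (Subset n) ℓ} (P? : Decidable P) →
  length (filter P? (allSubsets n)) ≡ count n (does ∘ P?)
length-filter-allSubsets zero    P? with does (P? [])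
... | true  = refl
... | false = refl
length-filter-allSubsets (suc n) P? = begin
  length (filter P? (map (outside ∷_) subsets ++ map (inside ∷_) subsets))
    ≡⟨ cong length (filter-++ P? (map (outside ∷_) subsets) _) ⟩
  length (filter P? (map (outside ∷_) subsets) ++ filter P? (map (inside ∷_) subsets))
    ≡⟨ length-++ (filter P? (map (outside ∷_) subsets)) ⟩
  length (filter P? (map (outside ∷_) subsets)) + length (filter P? (map (inside ∷_) subsets))
    ≡⟨ cong₂ _+_ (length-filter-map P? (outside ∷_) subsets) (length-filter-map P? (inside ∷_) subsets) ⟩
  length (filter (P? ∘ (outside ∷_)) subsets) + length (filter (P? ∘ (inside ∷_)) subsets)
    ≡⟨ cong₂ _+_ (length-filter-allSubsets n (P? ∘ (outside ∷_))) (length-filter-allSubsets n (P? ∘ (inside ∷_))) ⟩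
  count (suc n) (does ∘ P?) ∎
  where
  open ≡-Reasoning
  subsets = allSubsets n

InS : ∀ {n m} → ℕ → (Fin m → Subset n) → Subset n → Set
InS k A F = ∣ F ∣ ≡ k × ∃ λ i → A i ⊆ F

inS? : ∀ {n m} k (A : Fin m → Subset n) → Decidable (InS k A)
inS? k A F = (∣ F ∣ ≟ k) ×-dec any? (λ i → A i ⊆? F)

#S : ∀ {n m} → ℕ → (Fin m → Subset n) → ℕ
#S {n} k A = count n (does ∘ inS? k A)

sizeS≡#S : ∀ n k m (A : Fin m → Subset n) → sizeS n k m A ≡ #S k A
sizeS≡#S n k m A = trans
  (length-filter-filter (λ F → ∣ F ∣ ≟ k) (λ F → any? (λ i → A i ⊆? F)) (allSubsets n))
  (length-filter-allSubsets n (inS? k A))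

#S-≤-relabel : ∀ {n m} k (A : Fin m → Subset n) (π : Permutation′ n) → #S k A ≤ #S k (relabel π ∘ A)
#S-≤-relabel {n} k A π = begin
  #S k A                                               ≤⟨ count-mono-dec (inS? k A) (inS? k (relabel π ∘ A) ∘ relabel π) moves ⟩
  count n (does ∘ inS? k (relabel π ∘ A) ∘ relabel π)  ≡⟨ count-relabel n π (does ∘ inS? k (relabel π ∘ A)) ⟩
  #S k (relabel π ∘ A)                                 ∎
  where
  open ≤-Reasoning
  moves : ∀ {F} → InS k A F → InS k (relabel π ∘ A) (relabel π F)
  moves {F} (∣F∣≡k , i , Ai⊆F) = trans (∣relabel∣ n π F) ∣F∣≡k , i , relabel-mono π Ai⊆F

transpose-applyˡ : ∀ {n} (i j : Fin n) → transpose i j ⟨$⟩ʳ i ≡ j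
transpose-applyˡ i j rewrite dec-true (i ≟ᶠ i) refl = refl

transpose-applyʳ : ∀ {n} (i j : Fin n) → transpose i j ⟨$⟩ʳ j ≡ i
transpose-applyʳ i j with j ≟ᶠ i
... | yes refl = refl
... | no _ rewrite dec-true (j ≟ᶠ j) refl = refl

transpose-applyᵒ : ∀ {n} {i j k : Fin n} → k ≢ i → k ≢ j → transpose i j ⟨$⟩ʳ k ≡ k
transpose-applyᵒ {i = i} {j} {k} k≢i k≢j rewrite dec-false (k ≟ᶠ i) k≢i | dec-false (k ≟ᶠ j) k≢j = refl

transpose-involutive : ∀ {n} (i j k : Fin n) → transpose i j ⟨$⟩ʳ (transpose i j ⟨$⟩ʳ k) ≡ k
transpose-involutive i j k = cases (k ≟ᶠ i) (k ≟ᶠ j)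
  where
  τ = transpose i j ⟨$⟩ʳ_
  cases : Dec (k ≡ i) → Dec (k ≡ j) → τ (τ k) ≡ k
  cases (yes refl) _          = trans (cong τ (transpose-applyˡ k j)) (transpose-applyʳ k j)
  cases (no _)     (yes refl) = trans (cong τ (transpose-applyʳ i k)) (transpose-applyˡ i k)
  cases (no k≢i)   (no k≢j)   = trans (cong τ (transpose-applyᵒ k≢i k≢j)) (transpose-applyᵒ k≢i k≢j)

relabel-transpose-⊆ : ∀ {n} {x y : Fin n} {p q} → p ⊆ relabel (transpose x y) q → relabel (transpose x y) p ⊆ q
relabel-transpose-⊆ {x = x} {y} {q = q} p⊆σq {w} w∈σp =
  subst (_∈ q) (transpose-involutive x y w) (∈-relabel⁻ (transpose x y) (p⊆σq (∈-relabel⁻ (transpose x y) w∈σp)))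

⊆-relabel-transpose : ∀ {n} {x y : Fin n} {p q} → x ∈ q → y ∉ p → p ⊆ relabel (transpose x y) q → p ⊆ q
⊆-relabel-transpose {x = x} {y} {p} {q} x∈q y∉p p⊆σq {w} w∈p with w ≟ᶠ x | w ≟ᶠ y
... | yes refl | _        = x∈q
... | no _     | yes refl = contradiction w∈p y∉p
... | no w≢x   | no w≢y   = subst (_∈ q) (transpose-applyᵒ w≢x w≢y) (∈-relabel⁻ (transpose x y) (p⊆σq w∈p))

-- A set F that leaves 𝒮 must contain A i; swapping x and y in F gives a set that enters 𝒮,
-- because y lies in no A j.
#S-shift : ∀ {n m} k (A : Fin m → Subset n) {i x y} → x ∈ A i → (∀ j → y ∉ A j) →
  #S k A ≤ #S k (updateAt A i (relabel (transpose x y)))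
#S-shift k A {i} {x} {y} x∈Ai y∉A = count-≤-relabelling (inS? k A) (inS? k A′) σ moves
  where
  σ = transpose x y
  A′ = updateAt A i (relabel σ)
  A′≡ : ∀ {j} → j ≢ i → A′ j ≡ A j
  A′≡ {j} = updateAt-minimal j i A
  moves : ∀ {F} → InS k A F × ¬ InS k A′ F → InS k A′ (relabel σ F) × ¬ InS k A (relabel σ F)
  moves {F} ((∣F∣≡k , j , Aj⊆F) , F∉S′) =
    (trans (∣relabel∣ _ σ F) ∣F∣≡k , i , ⊆-trans (⊆-reflexive (updateAt-updates i A)) (relabel-mono σ Ai⊆F)) , σF∉S
    where
    Ai⊆F : A i ⊆ F
    Ai⊆F with j ≟ᶠ i
    ... | yes refl = Aj⊆F
    ... | no j≢i  = ⊥-elim (F∉S′ (∣F∣≡k , j , ⊆-trans (⊆-reflexive (A′≡ j≢i)) Aj⊆F))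
    σF∉S : ¬ InS k A (relabel σ F)
    σF∉S (_ , l , Al⊆σF) with l ≟ᶠ i
    ... | yes refl = F∉S′ (∣F∣≡k , l , ⊆-trans (⊆-reflexive (updateAt-updates l A)) (relabel-transpose-⊆ Al⊆σF))
    ... | no l≢i  = F∉S′ (∣F∣≡k , l , ⊆-trans (⊆-reflexive (A′≡ l≢i)) (⊆-relabel-transpose (Ai⊆F x∈Ai) (y∉A l) Al⊆σF))

∣p∪q∣≤∣p∣+∣q∣ : ∀ {n} (p q : Subset n) → ∣ p ∪ q ∣ ≤ ∣ p ∣ + ∣ q ∣
∣p∪q∣≤∣p∣+∣q∣ []            []            = z≤n
∣p∪q∣≤∣p∣+∣q∣ (outside ∷ p) (outside ∷ q) = ∣p∪q∣≤∣p∣+∣q∣ p q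
∣p∪q∣≤∣p∣+∣q∣ (outside ∷ p) (inside ∷ q)  = ≤-trans (s≤s (∣p∪q∣≤∣p∣+∣q∣ p q)) (≤-reflexive (sym (+-suc ∣ p ∣ ∣ q ∣)))
∣p∪q∣≤∣p∣+∣q∣ (inside ∷ p)  (outside ∷ q) = s≤s (∣p∪q∣≤∣p∣+∣q∣ p q)
∣p∪q∣≤∣p∣+∣q∣ (inside ∷ p)  (inside ∷ q)  = s≤s (≤-trans (∣p∪q∣≤∣p∣+∣q∣ p q) (+-monoʳ-≤ ∣ p ∣ (n≤1+n ∣ q ∣)))

∣p∣<n⇒∃∉ : ∀ {n} {p : Subset n} → ∣ p ∣ < n → ∃ λ y → y ∉ p
∣p∣<n⇒∃∉ {n} {p} ∣p∣<n with any? (λ y → ¬? (y ∈? p))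
... | yes y∉p = y∉p
... | no  ∄∉p = contradiction (≤-trans (≤-reflexive (sym (∣⊤∣≡n n))) (p⊆q⇒∣p∣≤∣q∣ ⊤⊆p)) (<⇒≱ ∣p∣<n)
  where
  ⊤⊆p : ⊤ ⊆ p
  ⊤⊆p {y} _ = decidable-stable (y ∈? p) (∄∉p ∘ (y ,_))

witness-⊈ : ∀ {n} {p q : Subset n} → ¬ p ⊆ q → ∃ λ x → x ∈ p × x ∉ q
witness-⊈ {p = p} {q} p⊈q with any? (λ x → x ∈? p ×-dec ¬? (x ∈? q))
... | yes x∈p∖q = x∈p∖q
... | no  ∄x∈p∖q = contradiction (λ {x} x∈p → decidable-stable (x ∈? q) (∄x∈p∖q ∘ (x ,_) ∘ (x∈p ,_))) p⊈q

p⊆q∧∣q∣≤∣p∣⇒q⊆p : ∀ {n} {p q : Subset n} → p ⊆ q → ∣ q ∣ ≤ ∣ p ∣ → q ⊆ p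
p⊆q∧∣q∣≤∣p∣⇒q⊆p {p = p} p⊆q ∣q∣≤∣p∣ {x} x∈q =
  decidable-stable (x ∈? p) λ x∉p → <⇒≱ (p⊂q⇒∣p∣<∣q∣ (p⊆q , x , x∈q , x∉p)) ∣q∣≤∣p∣

updateAt-preserves : ∀ {m a ℓ} {A : Set a} (P : A → Set ℓ) (xs : Fin m → A) i {f : A → A} →
  (∀ j → P (xs j)) → P (f (xs i)) → ∀ j → P (updateAt xs i f j)
updateAt-preserves P xs i P-xs P-fxsᵢ j with j ≟ᶠ i
... | yes refl = subst P (sym (updateAt-updates i xs)) P-fxsᵢ
... | no  j≢i  = subst P (sym (updateAt-minimal j i xs j≢i)) (P-xs j)

⋃ᵢ : ∀ {n m} → (Fin m → Subset n) → Subset n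
⋃ᵢ A = ⋃ (List.tabulate A)

∈⋃ᵢ⁺ : ∀ {n m} (A : Fin m → Subset n) i {x} → x ∈ A i → x ∈ ⋃ᵢ A
∈⋃ᵢ⁺ A zero    x∈A₀ = x∈p∪q⁺ (inj₁ x∈A₀)
∈⋃ᵢ⁺ A (suc i) x∈Aᵢ = x∈p∪q⁺ (inj₂ (∈⋃ᵢ⁺ (A ∘ suc) i x∈Aᵢ))

∈⋃ᵢ⁻ : ∀ {n m} (A : Fin m → Subset n) {x} → x ∈ ⋃ᵢ A → ∃ λ i → x ∈ A i
∈⋃ᵢ⁻ {m = zero}  A x∈⊥ = contradiction x∈⊥ ∉⊥
∈⋃ᵢ⁻ {m = suc m} A x∈⋃ with x∈p∪q⁻ (A zero) _ x∈⋃
... | inj₁ x∈A₀ = zero , x∈A₀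
... | inj₂ x∈⋃′ with i , x∈Aᵢ ← ∈⋃ᵢ⁻ (A ∘ suc) x∈⋃′ = suc i , x∈Aᵢ

∣⋃ᵢ∣≤ : ∀ {n m t} (A : Fin m → Subset n) → (∀ j → ∣ A j ∣ ≤ t) → ∣ ⋃ᵢ A ∣ ≤ m * t
∣⋃ᵢ∣≤ {n} {zero}  A _     = ≤-reflexive (∣⊥∣≡0 n)
∣⋃ᵢ∣≤ {m = suc m} A ∣A∣≤t =
  ≤-trans (∣p∪q∣≤∣p∣+∣q∣ (A zero) _) (+-mono-≤ (∣A∣≤t zero) (∣⋃ᵢ∣≤ (A ∘ suc) (∣A∣≤t ∘ suc)))

∣⋃ᵢ∣< : ∀ {n m t} (A : Fin m → Subset n) → (∀ j → ∣ A j ∣ ≤ t) → ∀ i → ∣ A i ∣ < t → ∣ ⋃ᵢ A ∣ < m * t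
∣⋃ᵢ∣< {m = suc m} A ∣A∣≤t zero    ∣A₀∣<t =
  <-≤-trans (s≤s (∣p∪q∣≤∣p∣+∣q∣ (A zero) _)) (+-mono-≤ ∣A₀∣<t (∣⋃ᵢ∣≤ (A ∘ suc) (∣A∣≤t ∘ suc)))
∣⋃ᵢ∣< {m = suc m} A ∣A∣≤t (suc i) ∣Aᵢ∣<t =
  ≤-<-trans (∣p∪q∣≤∣p∣+∣q∣ (A zero) _) (+-mono-≤-< (∣A∣≤t zero) (∣⋃ᵢ∣< (A ∘ suc) (∣A∣≤t ∘ suc) i ∣Aᵢ∣<t))

⋃ᵢ-⊆-updateAt : ∀ {n m} (A : Fin m → Subset n) {i l x} {f : Subset n → Subset n} → x ∈ A l → l ≢ i →
  (∀ {w} → w ∈ A i → w ≢ x → w ∈ f (A i)) → ⋃ᵢ A ⊆ ⋃ᵢ (updateAt A i f)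
⋃ᵢ-⊆-updateAt A {i} {l} {x} {f} x∈Aₗ l≢i keeps {w} w∈⋃A with ∈⋃ᵢ⁻ A w∈⋃A
... | j , w∈Aⱼ with j ≟ᶠ i
...   | no  j≢i  = ∈⋃ᵢ⁺ (updateAt A i f) j (⊆-reflexive (sym (updateAt-minimal j i A j≢i)) w∈Aⱼ)
...   | yes refl with w ≟ᶠ x
...     | yes refl = ∈⋃ᵢ⁺ (updateAt A i f) l (⊆-reflexive (sym (updateAt-minimal l i A l≢i)) x∈Aₗ)
...     | no  w≢x  = ∈⋃ᵢ⁺ (updateAt A i f) i (⊆-reflexive (sym (updateAt-updates i A)) (keeps w∈Aⱼ w≢x))

overlap⇒∃∉⋃ᵢ : ∀ {n m t} (A : Fin m → Subset n) → m * t ≤ n → (∀ j → ∣ A j ∣ ≤ t) →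
  ∀ {i l x} → x ∈ A i → x ∈ A l → l ≢ i → ∃ λ y → y ∉ ⋃ᵢ A
overlap⇒∃∉⋃ᵢ {n} {m} {t} A mt≤n ∣A∣≤t {i} {l} {x} x∈Aᵢ x∈Aₗ l≢i = ∣p∣<n⇒∃∉ (begin-strict
  ∣ ⋃ᵢ A ∣  ≤⟨ p⊆q⇒∣p∣≤∣q∣ (⋃ᵢ-⊆-updateAt A x∈Aₗ l≢i x∈p∧x≢y⇒x∈p-y) ⟩
  ∣ ⋃ᵢ B ∣  <⟨ ∣⋃ᵢ∣< B (updateAt-preserves (λ s → ∣ s ∣ ≤ t) A i ∣A∣≤t (<⇒≤ ∣Aᵢ-x∣<t)) i ∣Bᵢ∣<t ⟩
  m * t     ≤⟨ mt≤n ⟩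
  n         ∎)
  where
  open ≤-Reasoning
  B = updateAt A i (_- x)
  ∣Aᵢ-x∣<t : ∣ A i - x ∣ < t
  ∣Aᵢ-x∣<t = <-≤-trans (x∈p⇒∣p-x∣<∣p∣ x∈Aᵢ) (∣A∣≤t i)
  ∣Bᵢ∣<t : ∣ B i ∣ < t
  ∣Bᵢ∣<t = subst (λ s → ∣ s ∣ < t) (sym (updateAt-updates i A)) ∣Aᵢ-x∣<t

-- A′ moves x ∈ A i ∩ A l, inside A i, to a point y outside ⋃ A.
uncross : ∀ {n m t} k (A : Fin m → Subset n) → m * t ≤ n → IsTFamily n t m A →
  ∀ {i l x} → x ∈ A i → x ∈ A l → l ≢ i →
  ∃ λ A′ → IsTFamily n t m A′ × ⋃ᵢ A ⊂ ⋃ᵢ A′ × #S k A ≤ #S k A′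
uncross {n} {m} {t} k A mt≤n A-t {i} {l} {x} x∈Aᵢ x∈Aₗ l≢i =
  A′ , A′-t , (⋃ᵢ-⊆-updateAt A x∈Aₗ l≢i keeps , y , y∈⋃A′ , y∉⋃A) , #S-shift k A x∈Aᵢ y∉A
  where
  y∃ = overlap⇒∃∉⋃ᵢ A mt≤n (≤-reflexive ∘ A-t) x∈Aᵢ x∈Aₗ l≢i
  y = proj₁ y∃
  y∉⋃A = proj₂ y∃
  y∉A : ∀ j → y ∉ A j
  y∉A j = y∉⋃A ∘ ∈⋃ᵢ⁺ A j
  σ = transpose x y
  A′ = updateAt A i (relabel σ)
  A′-t : IsTFamily n t m A′
  A′-t = updateAt-preserves (λ s → ∣ s ∣ ≡ t) A i A-t (trans (∣relabel∣ n σ (A i)) (A-t i))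
  keeps : ∀ {w} → w ∈ A i → w ≢ x → w ∈ relabel σ (A i)
  keeps {w} w∈Aᵢ w≢x = ∈-relabel⁺ σ (subst (_∈ A i) (sym (transpose-applyᵒ w≢x w≢y)) w∈Aᵢ)
    where
    w≢y : w ≢ y
    w≢y refl = y∉A i w∈Aᵢ
  y∈⋃A′ : y ∈ ⋃ᵢ A′
  y∈⋃A′ = ∈⋃ᵢ⁺ A′ i (⊆-reflexive (sym (updateAt-updates i A))
                       (∈-relabel⁺ σ (subst (_∈ A i) (sym (transpose-applyʳ x y)) x∈Aᵢ)))

disjointify : ∀ {n m t} k → m * t ≤ n → (A : Fin m → Subset n) → IsTFamily n t m A → Acc _<_ ∣ ∁ (⋃ᵢ A) ∣ →
  ∃ λ D → IsTFamily n t m D × PairwiseDisjoint n m D × #S k A ≤ #S k D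
disjointify k mt≤n A A-t (acc rec) with any? (λ i → any? (λ l → ¬? (l ≟ᶠ i) ×-dec nonempty? (A i ∩ A l)))
... | no ∄overlap = A , A-t , (λ i l i≢l x∈Aᵢ∩Aₗ → ∄overlap (i , l , i≢l ∘ sym , x∈Aᵢ∩Aₗ)) , ≤-refl
... | yes (i , l , l≢i , x , x∈Aᵢ∩Aₗ) with x∈p∩q⁻ (A i) (A l) x∈Aᵢ∩Aₗ
... | x∈Aᵢ , x∈Aₗ with uncross k A mt≤n A-t x∈Aᵢ x∈Aₗ l≢i
... | A′ , A′-t , ⋃A⊂⋃A′ , A≤A′ with disjointify k mt≤n A′ A′-t (rec (p⊂q⇒∣p∣<∣q∣ (p⊂q⇒∁p⊃∁q ⋃A⊂⋃A′)))
... | D , D-t , D-disjoint , A′≤D = D , D-t , D-disjoint , ≤-trans A≤A′ A′≤D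

disjoint-index-unique : ∀ {n m} {D : Fin m → Subset n} → PairwiseDisjoint n m D →
  ∀ {a b x} → x ∈ D a → x ∈ D b → a ≡ b
disjoint-index-unique D-disj {a} {b} x∈Dₐ x∈D_b =
  decidable-stable (a ≟ᶠ b) λ a≢b → D-disj a b a≢b (_ , x∈p∩q⁺ (x∈Dₐ , x∈D_b))

relabel-disjoint : ∀ {n m} (π : Permutation′ n) {D : Fin m → Subset n} →
  PairwiseDisjoint n m D → PairwiseDisjoint n m (relabel π ∘ D)
relabel-disjoint π {D} D-disj a b a≢b (x , x∈πDₐ∩πD_b) with x∈p∩q⁻ _ _ x∈πDₐ∩πD_b
... | x∈πDₐ , x∈πD_b = D-disj a b a≢b (_ , x∈p∩q⁺ (∈-relabel⁻ π x∈πDₐ , ∈-relabel⁻ π x∈πD_b))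

agreement-grows : ∀ {n m} {D T′ : Fin m → Subset n} → PairwiseDisjoint n m D → PairwiseDisjoint n m T′ →
  ∀ {i z y} → z ∈ D i → z ∉ T′ i → y ∈ T′ i → y ∉ D i →
  ⋃ᵢ (λ a → D a ∩ T′ a) ⊂ ⋃ᵢ (λ a → relabel (transpose z y) (D a) ∩ T′ a)
agreement-grows {D = D} {T′} D-disj T′-disj {i} {z} {y} z∈Dᵢ z∉T′ᵢ y∈T′ᵢ y∉Dᵢ = kept , y , y∈new , y∉old
  where
  σ = transpose z y
  y∈new : y ∈ ⋃ᵢ (λ a → relabel σ (D a) ∩ T′ a)
  y∈new = ∈⋃ᵢ⁺ _ i (x∈p∩q⁺ (∈-relabel⁺ σ (subst (_∈ D i) (sym (transpose-applyʳ z y)) z∈Dᵢ) , y∈T′ᵢ))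
  y∉old : y ∉ ⋃ᵢ (λ a → D a ∩ T′ a)
  y∉old y∈old with a , y∈Dₐ∩T′ₐ ← ∈⋃ᵢ⁻ _ y∈old with y∈Dₐ , y∈T′ₐ ← x∈p∩q⁻ (D a) (T′ a) y∈Dₐ∩T′ₐ
    with refl ← disjoint-index-unique T′-disj y∈T′ₐ y∈T′ᵢ = y∉Dᵢ y∈Dₐ
  kept : ⋃ᵢ (λ a → D a ∩ T′ a) ⊆ ⋃ᵢ (λ a → relabel σ (D a) ∩ T′ a)
  kept {w} w∈old with a , w∈Dₐ∩T′ₐ ← ∈⋃ᵢ⁻ _ w∈old with w∈Dₐ , w∈T′ₐ ← x∈p∩q⁻ (D a) (T′ a) w∈Dₐ∩T′ₐ =
    ∈⋃ᵢ⁺ _ a (x∈p∩q⁺ (∈-relabel⁺ σ (subst (_∈ D a) (sym (transpose-applyᵒ w≢z w≢y)) w∈Dₐ) , w∈T′ₐ))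
    where
    w≢z : w ≢ z
    w≢z refl with refl ← disjoint-index-unique D-disj w∈Dₐ z∈Dᵢ = z∉T′ᵢ w∈T′ₐ
    w≢y : w ≢ y
    w≢y refl with refl ← disjoint-index-unique T′-disj w∈T′ₐ y∈T′ᵢ = y∉Dᵢ w∈Dₐ

#S-≤-disjoint : ∀ {n m} k (D T′ : Fin m → Subset n) → (∀ a → ∣ D a ∣ ≡ ∣ T′ a ∣) →
  PairwiseDisjoint n m D → PairwiseDisjoint n m T′ → Acc _<_ ∣ ∁ (⋃ᵢ (λ a → D a ∩ T′ a)) ∣ →
  #S k D ≤ #S k T′
#S-≤-disjoint k D T′ ∣D∣≡∣T′∣ D-disj T′-disj (acc rec) with all? (λ a → D a ⊆? T′ a)
... | yes D⊆T′ = count-mono-dec (inS? k D) (inS? k T′) λ (∣F∣≡k , a , Dₐ⊆F) →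
  ∣F∣≡k , a , ⊆-trans (p⊆q∧∣q∣≤∣p∣⇒q⊆p (D⊆T′ a) (≤-reflexive (sym (∣D∣≡∣T′∣ a)))) Dₐ⊆F
... | no D⊈T′ with i , Dᵢ⊈T′ᵢ ← ¬∀⟶∃¬ _ _ (λ a → D a ⊆? T′ a) D⊈T′
  with z , z∈Dᵢ , z∉T′ᵢ ← witness-⊈ Dᵢ⊈T′ᵢ
  with y , y∈T′ᵢ , y∉Dᵢ ← witness-⊈ {p = T′ i} (λ T′ᵢ⊆Dᵢ → Dᵢ⊈T′ᵢ (p⊆q∧∣q∣≤∣p∣⇒q⊆p T′ᵢ⊆Dᵢ (≤-reflexive (∣D∣≡∣T′∣ i)))) =
  ≤-trans (#S-≤-relabel k D (transpose z y))
          (#S-≤-disjoint k (relabel (transpose z y) ∘ D) T′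
            (λ a → trans (∣relabel∣ _ (transpose z y) (D a)) (∣D∣≡∣T′∣ a))
            (relabel-disjoint (transpose z y) D-disj) T′-disj
            (rec (p⊂q⇒∣p∣<∣q∣ (p⊂q⇒∁p⊃∁q (agreement-grows D-disj T′-disj z∈Dᵢ z∉T′ᵢ y∈T′ᵢ y∉Dᵢ)))))

lemma2p1 : (n k t m : ℕ) → .{{NonZero n}} → .{{NonZero k}} → .{{NonZero t}} → .{{NonZero m}} →
           t ≤ k → m * t ≤ n →
           (T : Fin m → Subset n) → IsTFamily n t m T → Distinct n m T →
           (T' : Fin m → Subset n) → IsTFamily n t m T' → Distinct n m T' → PairwiseDisjoint n m T' →
           sizeS n k m T ≤ sizeS n k m T'
lemma2p1 n k t m _ mt≤n T T-t _ T' T'-t _ T'-disj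
  with D , D-t , D-disj , T≤D ← disjointify k mt≤n T T-t (<-wellFounded _) = begin
  sizeS n k m T   ≡⟨ sizeS≡#S n k m T ⟩
  #S k T          ≤⟨ T≤D ⟩
  #S k D          ≤⟨ #S-≤-disjoint k D T' (λ a → trans (D-t a) (sym (T'-t a))) D-disj T'-disj (<-wellFounded _) ⟩
  #S k T'         ≡⟨ sizeS≡#S n k m T' ⟨
  sizeS n k m T'  ∎
  where open ≤-Reasoning
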